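{- Fix $n\in\mathbb{N}$, let $e(n)=2^{2^n}$, and let $\mathcal F,\mathcal C,\mathcal D$ be as in the context. Let $\preccurlyeq$ be any monomial ordering on the monomials in $\mathbb{X}$ such that (i) for every $\alpha\in\mathcal C$, $s\prec\alpha$; and (ii) for every $g\in\mathcal D$, if $f\in\mathrm{IdealRes}_{\mathcal F}(g)$, then $g\preccurlyeq f$. Then $|\mathrm{Gb}_{\preccurlyeq}(\mathcal F)|\ge e(n)$ and $|\{p\in\mathrm{Gb}_{\preccurlyeq}(\mathcal F):\deg(p)\ge e(n)\}|\ge e(n)$.
   Context: $\mathbb{Z}_2$ is the field with two elements. $\mathbb{X}$ is the finite set of distinct variables $\{s,\ell,c,\bar c,b,\bar b\}\cup\bigcup_{i=0}^n(V_i\cup\bar V_i)$, where $V_i=\{s_i,f_i,q_{1i},\dots,q_{4i},c_{1i},\dots,c_{4i},b_{1i},\dots,b_{4i}\}$ and $\bar V_i=\{\bar s_i,\bar f_i,\bar q_{ki},\bar c_{ki},\bar b_{ki}: k\in\{1,2,3,4\}\}$ (barred variables are new variables). Let $\mathcal P=\bigcup_{m=0}^{n}\mathcal P_m$, where $\mathcal P_0=\{b_{i0}^2c_{i0}f_0+c_{i0}s_0 : i\in\{1,2,3,4\}\}$ and, for $1\le m\le n$, $\mathcal P_m$ consists of $q_{1m}c_{1(m-1)}s_{m-1}+s_m$; $q_{2m}c_{2(m-1)}s_{m-1}+q_{1m}b_{1(m-1)}c_{1(m-1)}f_{m-1}$; $q_{3m}c_{3(m-1)}f_{m-1}+q_{2m}c_{2(m-1)}f_{m-1}$;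 $q_{3m}b_{1(m-1)}c_{3(m-1)}s_{m-1}+q_{2m}b_{4(m-1)}c_{2(m-1)}s_{m-1}$; $q_{4m}b_{4(m-1)}c_{4(m-1)}f_{m-1}+q_{3m}c_{3(m-1)}s_{m-1}$; $q_{4m}c_{4(m-1)}s_{m-1}+f_m$; and $q_{2m}b_{3(m-1)}b_{im}c_{im}f_{m-1}+q_{2m}b_{2(m-1)}c_{im}f_{m-1}$ for $i\in\{1,2,3,4\}$. Let $\bar{\mathcal P}$ be obtained from $\mathcal P$ by replacing every variable $s_i,f_i,q_{ki},c_{ki},b_{ki}$ by $\bar s_i,\bar f_i,\bar q_{ki},\bar c_{ki},\bar b_{ki}$. Let $\mathcal G=\{b_{4n}\ell b+\ell c,\ b_{4n}\ell\bar b+\ell\bar c,\ c_{4n}f_n+\ell,\ \bar c_{4n}\bar f_n+c_{4n}s_n,\ \bar b_{4n}c_{4n}s_n+c_{4n}s_nb,\ \bar b_{4n}c_{4n}s_n+c_{4n}s_n\bar b,\ \bar c_{4n}\bar s_n+s\}$ and $\mathcal F=\mathcal P\cup\bar{\mathcal P}\cup\mathcal G$. Let $\mathcal C=\{\ell\bar c^{m_1}c^{m_2}: m_1,m_2\ge 0,\ m_1+m_2=e(n)\}$ and $\mathcal D=\{\ell^j\bar c^{m_1}c^{m_2}: j\in\{0,1\},\ m_1,m_2\ge 0,\ j+m_1+m_2\le e(n)\}$. A monomial ordering is a total order $\preccurlyeq$ on monomials with $1\preccurlyeq t$ for all $t$ and $t_1\preccurlyeq t_2\Rightarrow t_1t_3\preccurlyeq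 t_2t_3$. It is extended to polynomials in $\mathbb{Z}_2[\mathbb{X}]$ by: $g\preccurlyeq f$ iff $g=f$, or the highest monomial of $g$ is strictly below the highest monomial of $f$, or they have the same highest monomial $t$ and $g-t\preccurlyeq f-t$ (recursively; the zero polynomial is below every nonzero polynomial). For $g\in\mathbb{Z}_2[\mathbb{X}]$, $\mathrm{IdealRes}_{\mathcal F}(g)=\{h\in\mathbb{Z}_2[\mathbb{X}]: g+h\in\langle\mathcal F\rangle\}$, where $\langle\mathcal F\rangle$ is the ideal generated by $\mathcal F$. $\mathrm{Gb}_{\preccurlyeq}(\mathcal F)$ denotes the reduced Gröbner basis of $\langle\mathcal F\rangle$ w.r.t. $\preccurlyeq$; the degree of a polynomial is the maximum total degree of its monomials. -}

module Defs where

open import Data.Bool using (Bool; true; false; not; if_then_else_)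
open import Data.Nat using (ℕ; zero; suc; _+_; _*_; _^_; _⊔_; _≤_)
import Data.Nat as ℕ
open import Data.Fin using (Fin; zero; suc; _↑ˡ_; _↑ʳ_; combine; inject₁; fromℕ; #_)
open import Data.Vec using (Vec; replicate; zipWith; tabulate; foldr)
import Data.Vec as Vec
open import Data.Vec.Properties using (≡-dec)
open import Data.List using (List; []; _∷_; _++_; map; concatMap; length)
import Data.List as List
open import Data.List.Membership.Propositional using (_∈_)
open import Data.List.Relation.Unary.All using (All)
open import Data.Product using (Σ; ∃; ∃-syntax; _×_; _,_)
open import Data.Sum using (_⊎_)
open import Relation.Binary.PropositionalEquality using (_≡_; _≢_)
open import Relation.Binary.Structures using (IsTotalOrder)
open import Relation.Nullary using (¬_; does)
import Relation.Nullary.Decidable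
import Relation.Binary.PropositionalEquality
open import Level using (0ℓ) renaming (suc to lsuc)

-- local variable names inside V_i :  s_i, f_i, q_{ki}, c_{ki}, b_{ki}
-- (k ∈ Fin 4 stands for k+1 ∈ {1,2,3,4})
data Loc : Set where
  Ls Lf : Loc
  Lq Lc Lb : Fin 4 → Loc

data Var (n : ℕ) : Set where
  vs vℓ vc vc̄ vb vb̄ : Var n
  -- V bar loc i : the variable loc_i, barred iff bar ≡ true
  V : Bool → Loc → Fin (suc n) → Var n

nv : ℕ → ℕ
nv n = 6 + (2 * suc n) * 14

encLoc : Loc → Fin 14
encLoc Ls = zero
encLoc Lf = suc zero
encLoc (Lq k) = 2 ↑ʳ (k ↑ˡ 8)
encLoc (Lc k) = 6 ↑ʳ (k ↑ˡ 4)
encLoc (Lb k) = 10 ↑ʳ k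

encBar : Bool → Fin 2
encBar false = zero
encBar true = suc zero

enc : ∀ {n} → Var n → Fin (nv n)
enc vs = zero
enc vℓ = suc zero
enc vc = suc (suc zero)
enc vc̄ = suc (suc (suc zero))
enc vb = suc (suc (suc (suc zero)))
enc vb̄ = suc (suc (suc (suc (suc zero))))
enc {n} (V β l i) = 6 ↑ʳ combine (combine (encBar β) i) (encLoc l)

record Mono (n : ℕ) : Set where
  constructor mk
  field exps : Vec ℕ (nv n)
open Mono public

ε : ∀ {n} → Mono n
ε = mk (replicate _ 0)

infixl 7 _·_
_·_ : ∀ {n} → Mono n → Mono n → Mono n
mk a · mk b = mk (zipWith _+_ a b)

x : ∀ {n} → Var n → Mono n
x v = mk (tabulate (λ j → if does (j Data.Fin.≟ enc v) then 1 else 0))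

_^ᵐ_ : ∀ {n} → Mono n → ℕ → Mono n
mk a ^ᵐ k = mk (Vec.map (k *_) a)

mon : ∀ {n} → List (Var n) → Mono n
mon = List.foldr (λ v t → x v · t) ε

totalDeg : ∀ {n} → Mono n → ℕ
totalDeg (mk a) = foldr _ _+_ 0 a

_≟ᵐ_ : ∀ {n} (t u : Mono n) → Relation.Nullary.Dec (t ≡ u)
mk a ≟ᵐ mk b = Relation.Nullary.Decidable.map′
  (Relation.Binary.PropositionalEquality.cong mk)
  (Relation.Binary.PropositionalEquality.cong exps)
  (≡-dec Data.Nat._≟_ a b)

_∣ᵐ_ : ∀ {n} → Mono n → Mono n → Set
t ∣ᵐ u = ∃[ w ] u ≡ t · w

-- Polynomials over ℤ₂: a list of monomials, read as their sum mod 2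

Poly : ℕ → Set
Poly n = List (Mono n)

coeff : ∀ {n} → Mono n → Poly n → Bool
coeff t = List.foldr (λ u acc → if does (u ≟ᵐ t) then not acc else acc) false

_≈_ : ∀ {n} → Poly n → Poly n → Set
p ≈ q = ∀ t → coeff t p ≡ coeff t q

0ᵖ : ∀ {n} → Poly n
0ᵖ = []

infixl 6 _⊕_
_⊕_ : ∀ {n} → Poly n → Poly n → Poly n
_⊕_ = _++_

infixl 7 _⊗_
_⊗_ : ∀ {n} → Poly n → Poly n → Poly n
p ⊗ q = concatMap (λ u → map (u ·_) q) p

⟦_⟧ : ∀ {n} → Mono n → Poly n
⟦ t ⟧ = t ∷ []

deg : ∀ {n} → Poly n → ℕ
deg p = List.foldr (λ u m → if coeff u p then totalDeg u ⊔ m else m) 0 p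

lincomb : ∀ {n} → List (Poly n × Poly n) → Poly n
lincomb = List.foldr (λ { (h , f) acc → h ⊗ f ⊕ acc }) 0ᵖ

_∈⟨_⟩ : ∀ {n} → Poly n → List (Poly n) → Set
p ∈⟨ F ⟩ = ∃[ cs ] (All (λ hf → Data.Product.proj₂ hf ∈ F) cs × p ≈ lincomb cs)

IdealRes : ∀ {n} → List (Poly n) → Poly n → Poly n → Set
IdealRes F g h = (g ⊕ h) ∈⟨ F ⟩

record MonomialOrder (n : ℕ) : Set₁ where
  field
    _≼_ : Mono n → Mono n → Set
    isTotalOrder : IsTotalOrder _≡_ _≼_
    one-least : ∀ t → ε ≼ t
    mult-compat : ∀ t₁ t₂ t₃ → t₁ ≼ t₂ → (t₁ · t₃) ≼ (t₂ · t₃)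

module _ {n : ℕ} (O : MonomialOrder n) where
  open MonomialOrder O

  _≺_ : Mono n → Mono n → Set
  t ≺ u = t ≼ u × t ≢ u

  IsLM : Poly n → Mono n → Set
  IsLM p t = coeff t p ≡ true × (∀ u → coeff u p ≡ true → u ≼ t)

  -- the extension of ≼ to polynomials (recursive definition, as an
  -- inductive relation)
  data _⊑_ (g f : Poly n) : Set where
    ⊑-eq : g ≈ f → g ⊑ f
    ⊑-zero : g ≈ 0ᵖ → ¬ (f ≈ 0ᵖ) → g ⊑ f
    ⊑-lt : ∀ t u → IsLM g t → IsLM f u → t ≺ u → g ⊑ f
    ⊑-step : ∀ t → IsLM g t → IsLM f t → (g ⊕ ⟦ t ⟧) ⊑ (f ⊕ ⟦ t ⟧) → g ⊑ f

  -- G is the reduced Gröbner basis of ⟨F⟩ w.r.t. ≼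
  -- (over ℤ₂ every nonzero polynomial is monic)
  record IsReducedGB (F : List (Poly n)) (G : List (Poly n)) : Set where
    field
      inIdeal : All (λ g → g ∈⟨ F ⟩) G
      nonzero : All (λ g → ¬ (g ≈ 0ᵖ)) G
      leading : ∀ p → p ∈⟨ F ⟩ → ¬ (p ≈ 0ᵖ) →
                ∃[ g ] ∃[ t ] ∃[ u ] (g ∈ G × IsLM g t × IsLM p u × t ∣ᵐ u)
      reduced : ∀ (i j : Fin (length G)) → i ≢ j → ∀ t u →
                IsLM (List.lookup G j) t → coeff u (List.lookup G i) ≡ true →
                ¬ (t ∣ᵐ u)

e : ℕ → ℕ
e n = 2 ^ (2 ^ n)

bin : ∀ {n} → List (Var n) → List (Var n) → Poly n
bin as bs = mon as ∷ mon bs ∷ []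

module Sys (n : ℕ) where
  S F : Bool → Fin (suc n) → Var n
  S β = V β Ls
  F β = V β Lf
  Q C B : Bool → Fin 4 → Fin (suc n) → Var n
  Q β k = V β (Lq k)
  C β k = V β (Lc k)
  B β k = V β (Lb k)

  k₁ k₂ k₃ k₄ : Fin 4
  k₁ = # 0
  k₂ = # 1
  k₃ = # 2
  k₄ = # 3

  P₀ : Bool → List (Poly n)
  P₀ β = map (λ i → bin (B β i zero ∷ B β i zero ∷ C β i zero ∷ F β zero ∷ [])
                        (C β i zero ∷ S β zero ∷ []))
             (Data.List.allFin 4)

  Pₘ : Bool → Fin n → List (Poly n)
  Pₘ β j =
      bin (Q β k₁ m ∷ C β k₁ p ∷ S β p ∷ []) (S β m ∷ [])
    ∷ bin (Q β k₂ m ∷ C β k₂ p ∷ S β p ∷ []) (Q β k₁ m ∷ B β k₁ p ∷ C β k₁ p ∷ F β p ∷ [])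
    ∷ bin (Q β k₃ m ∷ C β k₃ p ∷ F β p ∷ []) (Q β k₂ m ∷ C β k₂ p ∷ F β p ∷ [])
    ∷ bin (Q β k₃ m ∷ B β k₁ p ∷ C β k₃ p ∷ S β p ∷ []) (Q β k₂ m ∷ B β k₄ p ∷ C β k₂ p ∷ S β p ∷ [])
    ∷ bin (Q β k₄ m ∷ B β k₄ p ∷ C β k₄ p ∷ F β p ∷ []) (Q β k₃ m ∷ C β k₃ p ∷ S β p ∷ [])
    ∷ bin (Q β k₄ m ∷ C β k₄ p ∷ S β p ∷ []) (F β m ∷ [])
    ∷ map (λ i → bin (Q β k₂ m ∷ B β k₃ p ∷ B β i m ∷ C β i m ∷ F β p ∷ [])
                     (Q β k₂ m ∷ B β k₂ p ∷ C β i m ∷ F β p ∷ []))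
          (Data.List.allFin 4)
    where
      m p : Fin (suc n)
      m = suc j
      p = inject₁ j

  -- 𝒫 (β = false) and 𝒫̄ (β = true)
  𝒫 : Bool → List (Poly n)
  𝒫 β = P₀ β ++ concatMap (Pₘ β) (Data.List.allFin n)

  N : Fin (suc n)
  N = fromℕ n

  𝒢 : List (Poly n)
  𝒢 =
      bin (B false k₄ N ∷ vℓ ∷ vb ∷ []) (vℓ ∷ vc ∷ [])
    ∷ bin (B false k₄ N ∷ vℓ ∷ vb̄ ∷ []) (vℓ ∷ vc̄ ∷ [])
    ∷ bin (C false k₄ N ∷ F false N ∷ []) (vℓ ∷ [])
    ∷ bin (C true k₄ N ∷ F true N ∷ []) (C false k₄ N ∷ S false N ∷ [])
    ∷ bin (B true k₄ N ∷ C false k₄ N ∷ S false N ∷ []) (C false k₄ N ∷ S false N ∷ vb ∷ [])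
    ∷ bin (B true k₄ N ∷ C false k₄ N ∷ S false N ∷ []) (C false k₄ N ∷ S false N ∷ vb̄ ∷ [])
    ∷ bin (C true k₄ N ∷ S true N ∷ []) (vs ∷ [])
    ∷ []

  ℱ : List (Poly n)
  ℱ = 𝒫 false ++ 𝒫 true ++ 𝒢

  -- elements of 𝒞 : ℓ c̄^{m₁} c^{m₂}, m₁ + m₂ = e(n)
  𝒞-elt : ℕ → ℕ → Mono n
  𝒞-elt m₁ m₂ = x vℓ · (x vc̄ ^ᵐ m₁) · (x vc ^ᵐ m₂)

  -- elements of 𝒟 : ℓ^j c̄^{m₁} c^{m₂}, j ∈ {0,1}, j + m₁ + m₂ ≤ e(n)
  𝒟-elt : ℕ → ℕ → ℕ → Mono n
  𝒟-elt j m₁ m₂ = (x vℓ ^ᵐ j) · (x vc̄ ^ᵐ m₁) · (x vc ^ᵐ m₂)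

module Submission where

-- Call monomials congruent when one arises from the other by repeatedly replacing, inside a
-- monomial, one side of a binomial of ℱ by the other side; congruent monomials differ by an element
-- of ⟨ℱ⟩. The binomials of level m square exponents: c_{km} f_m b_{km}^{e(m)} is congruent to
-- c_{km} s_m, where e(m) = 2^(2^m). The binomials of 𝒢 turn the relations of level n into
-- ℓ c̄^m₁ c^m₂ ∼ s for every m₁ + m₂ = e(n), so each α ∈ 𝒞 yields α + s ∈ ⟨ℱ⟩, whose leading monomial
-- is α by (i). Some element of the Gröbner basis has a leading monomial t dividing α. If t ≠ α then
-- t ∈ 𝒟, and cancelling t from that element gives a residue of t with only smaller monomials,
-- contradicting (ii). Hence the e(n) + 1 monomials of 𝒞 lead distinct basis elements, each of degree
-- at least e(n).

open import Algebra.Bundles using (CommutativeMonoid)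
open import Data.Bool using (Bool; true; false; _xor_; if_then_else_)
open import Data.Bool.Properties using (xor-assoc; xor-comm; xor-identityʳ; xor-same)
open import Data.Empty using (⊥-elim)
open import Data.Fin using (Fin; zero; suc; _≟_; toℕ; inject₁; #_)
open import Data.Fin.Induction using (<-weakInduction)
import Data.Fin.Properties as Finₚ
open import Data.List using (List; []; _∷_; _++_; foldl; lookup; length; filter)
import Data.List as List
open import Data.List.Properties using (++-assoc; length-filter)
open import Data.List.Membership.Propositional using (_∈_)
open import Data.List.Membership.Propositional.Properties
  using (∈-lookup; ∈-map⁺; ∈-allFin; ∈-++⁺ˡ; ∈-++⁺ʳ; ∈-concat⁺′; ∈-filter⁺)
open import Data.List.Relation.Unary.All using ([]; _∷_)
import Data.List.Relation.Unary.All as All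
open import Data.List.Relation.Unary.All.Properties using (++⁺)
open import Data.List.Relation.Unary.Any using (here; there; index)
open import Data.List.Relation.Unary.Any.Properties using (lookup-index)
open import Data.Nat using (ℕ; zero; suc; _+_; _*_; _∸_; _≤_; _<_; _≤?_; _⊔_; NonZero)
import Data.Nat as ℕ
import Data.Nat.Properties as ℕ
open import Data.Nat.Tactic.RingSolver using (solve-∀)
open import Data.Product using (_×_; _,_; proj₁; proj₂; ∃-syntax)
open import Data.Sum using (inj₁; inj₂)
open import Data.Vec using (Vec; []; _∷_)
import Data.Vec as Vec
open import Data.Vec.Properties
  using (zipWith-assoc; zipWith-comm; zipWith-identityˡ; zipWith-identityʳ;
         lookup-zipWith; lookup-map; lookup∘tabulate; lookup-replicate)
open import Data.Vec.Relation.Binary.Pointwise.Extensional using (ext; Pointwise-≡⇒≡)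
open import Function using (case_of_)
open import Level using (0ℓ)
open import Relation.Binary.Core using (Rel)
open import Relation.Binary.Construct.Closure.Equivalence as EqClosure using (EqClosure)
open import Relation.Binary.PropositionalEquality
  using (_≡_; _≢_; refl; sym; trans; cong; cong₂; subst; subst₂; module ≡-Reasoning)
open import Relation.Binary.Structures using (IsEquivalence; IsTotalOrder)
open import Relation.Nullary using (¬_; yes; no)
open import Relation.Nullary.Decidable using (does; dec-true; dec-false)

open import Defs renaming (_≈_ to _≈ᵖ_)

+-mono-<-unless-equal : ∀ {a b c x y z} → a ≤ x → b ≤ y → c ≤ z → ¬ (a ≡ x × b ≡ y × c ≡ z) →
                        a + b + c < x + y + z
+-mono-<-unless-equal {a} {b} a≤x b≤y c≤z ≢
  with ℕ.m≤n⇒m<n∨m≡n a≤x | ℕ.m≤n⇒m<n∨m≡n b≤y | ℕ.m≤n⇒m<n∨m≡n c≤z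
... | inj₁ a<x  | _         | _         = ℕ.+-mono-<-≤ (ℕ.+-mono-<-≤ a<x b≤y) c≤z
... | inj₂ refl | inj₁ b<y  | _         = ℕ.+-mono-<-≤ (ℕ.+-monoʳ-< a b<y) c≤z
... | inj₂ refl | inj₂ refl | inj₁ c<z  = ℕ.+-monoʳ-< (a + b) c<z
... | inj₂ refl | inj₂ refl | inj₂ refl = ⊥-elim (≢ (refl , refl , refl))

e-suc : ∀ k → e (suc k) ≡ e k * e k
e-suc k = trans (cong (2 ℕ.^_) (cong (2 ℕ.^ k +_) (ℕ.+-identityʳ (2 ℕ.^ k)))) (ℕ.^-distribˡ-+-* 2 (2 ℕ.^ k) (2 ℕ.^ k))

e-nonZero : ∀ k → NonZero (e k)
e-nonZero k = ℕ.m^n≢0 2 (2 ℕ.^ k)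

injection⇒≤length : ∀ {A : Set} {k} (xs : List A) (f : Fin k → A) →
                    (∀ i → f i ∈ xs) → (∀ {i j} → f i ≡ f j → i ≡ j) → k ≤ length xs
injection⇒≤length xs f f∈xs f-injective = Finₚ.injective⇒≤ {f = position} λ {i} {j} same-position →
  f-injective (trans (lookup-index (f∈xs i)) (trans (cong (lookup xs) same-position) (sym (lookup-index (f∈xs j)))))
  where
  position : Fin _ → Fin (length xs)
  position i = index (f∈xs i)

-- Rewriting with binomials in a commutative monoid

module InCommutativeMonoid {c ℓ} (M : CommutativeMonoid c ℓ) where
  open CommutativeMonoid M renaming (refl to ≈-refl; sym to ≈-sym; trans to ≈-trans)
  open import Algebra.Definitions.RawMonoid rawMonoid using () renaming (_×_ to _×ᴹ_)
  open import Algebra.Properties.Monoid.Mult monoid using (×-homo-+; ×-assocˡ)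
  open import Algebra.Properties.CommutativeMonoid.Mult M using (×-distrib-+)
  open import Algebra.Properties.CommutativeSemigroup commutativeSemigroup using (x∙yz≈y∙xz; x∙yz≈z∙xy)
  open import Algebra.Solver.CommutativeMonoid M using (solve; _⊜_; Expr) renaming (_⊕_ to _⊕ᴱ_)
  open import Relation.Binary.Reasoning.Setoid setoid

  infixl 7 _⊙_
  _⊙_ : ∀ {k} → Expr k → Expr k → Expr k
  _⊙_ = _⊕ᴱ_

  infixr 8 _^_
  _^_ : Carrier → ℕ → Carrier
  a ^ k = k ×ᴹ a

  ^-transfer : ∀ {u a b} → u ∙ a ≈ u ∙ b → ∀ k → u ∙ a ^ k ≈ u ∙ b ^ k
  ^-transfer ua≈ub zero = ≈-refl
  ^-transfer {u} {a} {b} ua≈ub (suc k) = begin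
    u ∙ (a ∙ a ^ k)  ≈⟨ x∙yz≈z∙xy u a (a ^ k) ⟩
    a ^ k ∙ (u ∙ a)  ≈⟨ ∙-congˡ ua≈ub ⟩
    a ^ k ∙ (u ∙ b)  ≈⟨ solve 3 (λ A u b → A ⊙ (u ⊙ b) ⊜ b ⊙ (u ⊙ A)) ≈-refl (a ^ k) u b ⟩
    b ∙ (u ∙ a ^ k)  ≈⟨ ∙-congˡ (^-transfer ua≈ub k) ⟩
    b ∙ (u ∙ b ^ k)  ≈⟨ x∙yz≈y∙xz b u (b ^ k) ⟩
    u ∙ (b ∙ b ^ k)  ∎

  ^-distrib-∙ : ∀ a b k → (a ∙ b) ^ k ≈ a ^ k ∙ b ^ k
  ^-distrib-∙ a b k = ×-distrib-+ a b k

  ^-+ : ∀ a m k → a ^ (m + k) ≈ a ^ m ∙ a ^ k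
  ^-+ a m k = ×-homo-+ a m k

  ^-^ : ∀ a m k → (a ^ m) ^ k ≈ a ^ (k * m)
  ^-^ a m k = ×-assocˡ a k m

  -- One level of the construction: lower-case letters are the variables of level m − 1,
  -- S, F stand for s_m, f_m and B, C for b_{im}, c_{im}; p₁ … p₇ are the binomials of 𝒫_m.
  module Squaring
    (q₁ q₂ q₃ q₄ c₁ c₂ c₃ c₄ b₁ b₂ b₃ b₄ s f S F B C : Carrier) (d : ℕ)
    (p₁ : q₁ ∙ c₁ ∙ s ≈ S)
    (p₂ : q₂ ∙ c₂ ∙ s ≈ q₁ ∙ b₁ ∙ c₁ ∙ f)
    (p₃ : q₃ ∙ c₃ ∙ f ≈ q₂ ∙ c₂ ∙ f)
    (p₄ : q₃ ∙ b₁ ∙ c₃ ∙ s ≈ q₂ ∙ b₄ ∙ c₂ ∙ s)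
    (p₅ : q₄ ∙ b₄ ∙ c₄ ∙ f ≈ q₃ ∙ c₃ ∙ s)
    (p₆ : q₄ ∙ c₄ ∙ s ≈ F)
    (p₇ : q₂ ∙ b₃ ∙ B ∙ C ∙ f ≈ q₂ ∙ b₂ ∙ C ∙ f)
    (ih₁ : c₁ ∙ f ∙ b₁ ^ suc d ≈ c₁ ∙ s)
    (ih₂ : c₂ ∙ f ∙ b₂ ^ suc d ≈ c₂ ∙ s)
    (ih₃ : c₃ ∙ f ∙ b₃ ^ suc d ≈ c₃ ∙ s)
    (ih₄ : c₄ ∙ f ∙ b₄ ^ suc d ≈ c₄ ∙ s)
    where

    private
      E : ℕ
      E = suc d

    b₃B-to-b₂ : q₂ ∙ C ∙ f ∙ (b₃ ^ E ∙ B ^ E) ≈ q₂ ∙ C ∙ f ∙ b₂ ^ E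
    b₃B-to-b₂ = begin
      q₂ ∙ C ∙ f ∙ (b₃ ^ E ∙ B ^ E)
        ≈⟨ ∙-congˡ (^-distrib-∙ b₃ B E) ⟨
      q₂ ∙ C ∙ f ∙ (b₃ ∙ B) ^ E
        ≈⟨ ^-transfer p₇′ E ⟩
      q₂ ∙ C ∙ f ∙ b₂ ^ E ∎
      where
      p₇′ : q₂ ∙ C ∙ f ∙ (b₃ ∙ B) ≈ q₂ ∙ C ∙ f ∙ b₂
      p₇′ = begin
        q₂ ∙ C ∙ f ∙ (b₃ ∙ B)
          ≈⟨ solve 5 (λ q₂ C f b₃ B → q₂ ⊙ C ⊙ f ⊙ (b₃ ⊙ B) ⊜ q₂ ⊙ b₃ ⊙ B ⊙ C ⊙ f) ≈-refl q₂ C f b₃ B ⟩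
        q₂ ∙ b₃ ∙ B ∙ C ∙ f
          ≈⟨ p₇ ⟩
        q₂ ∙ b₂ ∙ C ∙ f
          ≈⟨ solve 4 (λ q₂ b₂ C f → q₂ ⊙ b₂ ⊙ C ⊙ f ⊜ q₂ ⊙ C ⊙ f ⊙ b₂) ≈-refl q₂ b₂ C f ⟩
        q₂ ∙ C ∙ f ∙ b₂ ∎

    c₂s-to-c₃s : C ∙ q₂ ∙ c₂ ∙ s ≈ C ∙ q₃ ∙ c₃ ∙ s ∙ B ^ E
    c₂s-to-c₃s = begin
      C ∙ q₂ ∙ c₂ ∙ s
        ≈⟨ assoc (C ∙ q₂) c₂ s ⟩
      C ∙ q₂ ∙ (c₂ ∙ s)
        ≈⟨ ∙-congˡ ih₂ ⟨
      C ∙ q₂ ∙ (c₂ ∙ f ∙ b₂ ^ E)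
        ≈⟨ solve 5 (λ C q₂ c₂ f P → C ⊙ q₂ ⊙ (c₂ ⊙ f ⊙ P) ⊜ c₂ ⊙ (q₂ ⊙ C ⊙ f ⊙ P)) ≈-refl C q₂ c₂ f (b₂ ^ E) ⟩
      c₂ ∙ (q₂ ∙ C ∙ f ∙ b₂ ^ E)
        ≈⟨ ∙-congˡ b₃B-to-b₂ ⟨
      c₂ ∙ (q₂ ∙ C ∙ f ∙ (b₃ ^ E ∙ B ^ E))
        ≈⟨ solve 6 (λ c₂ q₂ C f P Q → c₂ ⊙ (q₂ ⊙ C ⊙ f ⊙ (P ⊙ Q)) ⊜ C ⊙ P ⊙ Q ⊙ (q₂ ⊙ c₂ ⊙ f)) ≈-refl c₂ q₂ C f (b₃ ^ E) (B ^ E) ⟩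
      C ∙ b₃ ^ E ∙ B ^ E ∙ (q₂ ∙ c₂ ∙ f)
        ≈⟨ ∙-congˡ p₃ ⟨
      C ∙ b₃ ^ E ∙ B ^ E ∙ (q₃ ∙ c₃ ∙ f)
        ≈⟨ solve 6 (λ C P Q q₃ c₃ f → C ⊙ P ⊙ Q ⊙ (q₃ ⊙ c₃ ⊙ f) ⊜ C ⊙ q₃ ⊙ Q ⊙ (c₃ ⊙ f ⊙ P)) ≈-refl C (b₃ ^ E) (B ^ E) q₃ c₃ f ⟩
      C ∙ q₃ ∙ B ^ E ∙ (c₃ ∙ f ∙ b₃ ^ E)
        ≈⟨ ∙-congˡ ih₃ ⟩
      C ∙ q₃ ∙ B ^ E ∙ (c₃ ∙ s)
        ≈⟨ solve 5 (λ C q₃ Q c₃ s → C ⊙ q₃ ⊙ Q ⊙ (c₃ ⊙ s) ⊜ C ⊙ q₃ ⊙ c₃ ⊙ s ⊙ Q) ≈-refl C q₃ (B ^ E) c₃ s ⟩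
      C ∙ q₃ ∙ c₃ ∙ s ∙ B ^ E ∎

    b₁-to-b₄B : ∀ k → C ∙ q₃ ∙ c₃ ∙ s ∙ b₁ ^ k ≈ C ∙ q₃ ∙ c₃ ∙ s ∙ (b₄ ∙ B ^ E) ^ k
    b₁-to-b₄B = ^-transfer (begin
      C ∙ q₃ ∙ c₃ ∙ s ∙ b₁
        ≈⟨ solve 5 (λ C q₃ c₃ s b₁ → C ⊙ q₃ ⊙ c₃ ⊙ s ⊙ b₁ ⊜ C ⊙ (q₃ ⊙ b₁ ⊙ c₃ ⊙ s)) ≈-refl C q₃ c₃ s b₁ ⟩
      C ∙ (q₃ ∙ b₁ ∙ c₃ ∙ s)
        ≈⟨ ∙-congˡ p₄ ⟩
      C ∙ (q₂ ∙ b₄ ∙ c₂ ∙ s)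
        ≈⟨ solve 5 (λ C q₂ b₄ c₂ s → C ⊙ (q₂ ⊙ b₄ ⊙ c₂ ⊙ s) ⊜ b₄ ⊙ (C ⊙ q₂ ⊙ c₂ ⊙ s)) ≈-refl C q₂ b₄ c₂ s ⟩
      b₄ ∙ (C ∙ q₂ ∙ c₂ ∙ s)
        ≈⟨ ∙-congˡ c₂s-to-c₃s ⟩
      b₄ ∙ (C ∙ q₃ ∙ c₃ ∙ s ∙ B ^ E)
        ≈⟨ solve 6 (λ b₄ C q₃ c₃ s Q → b₄ ⊙ (C ⊙ q₃ ⊙ c₃ ⊙ s ⊙ Q) ⊜ C ⊙ q₃ ⊙ c₃ ⊙ s ⊙ (b₄ ⊙ Q)) ≈-refl b₄ C q₃ c₃ s (B ^ E) ⟩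
      C ∙ q₃ ∙ c₃ ∙ s ∙ (b₄ ∙ B ^ E) ∎)

    squaring : C ∙ F ∙ B ^ (E * E) ≈ C ∙ S
    squaring = ≈-sym (begin
      C ∙ S
        ≈⟨ ∙-congˡ p₁ ⟨
      C ∙ (q₁ ∙ c₁ ∙ s)
        ≈⟨ solve 4 (λ C q₁ c₁ s → C ⊙ (q₁ ⊙ c₁ ⊙ s) ⊜ C ⊙ q₁ ⊙ (c₁ ⊙ s)) ≈-refl C q₁ c₁ s ⟩
      C ∙ q₁ ∙ (c₁ ∙ s)
        ≈⟨ ∙-congˡ ih₁ ⟨
      C ∙ q₁ ∙ (c₁ ∙ f ∙ b₁ ^ E)
        ≈⟨ solve 6 (λ C q₁ c₁ f b₁ P → C ⊙ q₁ ⊙ (c₁ ⊙ f ⊙ (b₁ ⊙ P)) ⊜ C ⊙ P ⊙ (q₁ ⊙ b₁ ⊙ c₁ ⊙ f)) ≈-refl C q₁ c₁ f b₁ (b₁ ^ d) ⟩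
      C ∙ b₁ ^ d ∙ (q₁ ∙ b₁ ∙ c₁ ∙ f)
        ≈⟨ ∙-congˡ p₂ ⟨
      C ∙ b₁ ^ d ∙ (q₂ ∙ c₂ ∙ s)
        ≈⟨ solve 5 (λ C P q₂ c₂ s → C ⊙ P ⊙ (q₂ ⊙ c₂ ⊙ s) ⊜ P ⊙ (C ⊙ q₂ ⊙ c₂ ⊙ s)) ≈-refl C (b₁ ^ d) q₂ c₂ s ⟩
      b₁ ^ d ∙ (C ∙ q₂ ∙ c₂ ∙ s)
        ≈⟨ ∙-congˡ c₂s-to-c₃s ⟩
      b₁ ^ d ∙ (C ∙ q₃ ∙ c₃ ∙ s ∙ B ^ E)
        ≈⟨ solve 6 (λ P C q₃ c₃ s Q → P ⊙ (C ⊙ q₃ ⊙ c₃ ⊙ s ⊙ Q) ⊜ Q ⊙ (C ⊙ q₃ ⊙ c₃ ⊙ s ⊙ P)) ≈-refl (b₁ ^ d) C q₃ c₃ s (B ^ E) ⟩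
      B ^ E ∙ (C ∙ q₃ ∙ c₃ ∙ s ∙ b₁ ^ d)
        ≈⟨ ∙-congˡ (b₁-to-b₄B d) ⟩
      B ^ E ∙ (C ∙ q₃ ∙ c₃ ∙ s ∙ (b₄ ∙ B ^ E) ^ d)
        ≈⟨ ∙-congˡ (∙-congˡ (^-distrib-∙ b₄ (B ^ E) d)) ⟩
      B ^ E ∙ (C ∙ q₃ ∙ c₃ ∙ s ∙ (b₄ ^ d ∙ (B ^ E) ^ d))
        ≈⟨ solve 7 (λ Q C q₃ c₃ s P R → Q ⊙ (C ⊙ q₃ ⊙ c₃ ⊙ s ⊙ (P ⊙ R)) ⊜ Q ⊙ R ⊙ C ⊙ P ⊙ (q₃ ⊙ c₃ ⊙ s)) ≈-refl (B ^ E) C q₃ c₃ s (b₄ ^ d) ((B ^ E) ^ d) ⟩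
      B ^ E ∙ (B ^ E) ^ d ∙ C ∙ b₄ ^ d ∙ (q₃ ∙ c₃ ∙ s)
        ≈⟨ ∙-congˡ p₅ ⟨
      B ^ E ∙ (B ^ E) ^ d ∙ C ∙ b₄ ^ d ∙ (q₄ ∙ b₄ ∙ c₄ ∙ f) ≈⟨ solve 8 (λ Q R C P q₄ b₄ c₄ f → Q ⊙ R ⊙ C ⊙ P ⊙ (q₄ ⊙ b₄ ⊙ c₄ ⊙ f) ⊜ Q ⊙ R ⊙ C ⊙ q₄ ⊙ (c₄ ⊙ f ⊙ (b₄ ⊙ P))) ≈-refl (B ^ E) ((B ^ E) ^ d) C (b₄ ^ d) q₄ b₄ c₄ f ⟩
      B ^ E ∙ (B ^ E) ^ d ∙ C ∙ q₄ ∙ (c₄ ∙ f ∙ b₄ ^ E)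
        ≈⟨ ∙-congˡ ih₄ ⟩
      B ^ E ∙ (B ^ E) ^ d ∙ C ∙ q₄ ∙ (c₄ ∙ s)
        ≈⟨ solve 6 (λ Q R C q₄ c₄ s → Q ⊙ R ⊙ C ⊙ q₄ ⊙ (c₄ ⊙ s) ⊜ Q ⊙ R ⊙ C ⊙ (q₄ ⊙ c₄ ⊙ s)) ≈-refl (B ^ E) ((B ^ E) ^ d) C q₄ c₄ s ⟩
      B ^ E ∙ (B ^ E) ^ d ∙ C ∙ (q₄ ∙ c₄ ∙ s)
        ≈⟨ ∙-congˡ p₆ ⟩
      B ^ E ∙ (B ^ E) ^ d ∙ C ∙ F
        ≈⟨ solve 4 (λ Q R C F → Q ⊙ R ⊙ C ⊙ F ⊜ C ⊙ F ⊙ (Q ⊙ R)) ≈-refl (B ^ E) ((B ^ E) ^ d) C F ⟩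
      C ∙ F ∙ (B ^ E) ^ E
        ≈⟨ ∙-congˡ (^-^ B E E) ⟩
      C ∙ F ∙ B ^ (E * E) ∎)

  -- B, C, F, S stand for b_{4n}, c_{4n}, f_n, s_n and B̄, C̄, F̄, S̄ for their barred copies;
  -- g₁ … g₇ are the binomials of 𝒢.
  module Closing
    (ℓ c c̄ b b̄ B C F S B̄ C̄ F̄ S̄ s : Carrier)
    (g₁ : B ∙ ℓ ∙ b ≈ ℓ ∙ c)
    (g₂ : B ∙ ℓ ∙ b̄ ≈ ℓ ∙ c̄)
    (g₃ : C ∙ F ≈ ℓ)
    (g₄ : C̄ ∙ F̄ ≈ C ∙ S)
    (g₅ : B̄ ∙ C ∙ S ≈ C ∙ S ∙ b)
    (g₆ : B̄ ∙ C ∙ S ≈ C ∙ S ∙ b̄)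
    (g₇ : C̄ ∙ S̄ ≈ s)
    where

    c-from-Bb : ∀ k → ℓ ∙ (B ∙ b) ^ k ≈ ℓ ∙ c ^ k
    c-from-Bb = ^-transfer (≈-trans (solve 3 (λ ℓ B b → ℓ ⊙ (B ⊙ b) ⊜ B ⊙ ℓ ⊙ b) ≈-refl ℓ B b) g₁)

    c̄-from-Bb̄ : ∀ k → ℓ ∙ (B ∙ b̄) ^ k ≈ ℓ ∙ c̄ ^ k
    c̄-from-Bb̄ = ^-transfer (≈-trans (solve 3 (λ ℓ B b̄ → ℓ ⊙ (B ⊙ b̄) ⊜ B ⊙ ℓ ⊙ b̄) ≈-refl ℓ B b̄) g₂)

    b-to-B̄ : ∀ k → C ∙ S ∙ b ^ k ≈ C ∙ S ∙ B̄ ^ k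
    b-to-B̄ = ^-transfer (≈-trans (≈-sym g₅) (solve 3 (λ B̄ C S → B̄ ⊙ C ⊙ S ⊜ C ⊙ S ⊙ B̄) ≈-refl B̄ C S))

    b̄-to-B̄ : ∀ k → C ∙ S ∙ b̄ ^ k ≈ C ∙ S ∙ B̄ ^ k
    b̄-to-B̄ = ^-transfer (≈-trans (≈-sym g₆) (solve 3 (λ B̄ C S → B̄ ⊙ C ⊙ S ⊜ C ⊙ S ⊙ B̄) ≈-refl B̄ C S))

    closing : ∀ m₁ m₂ → C ∙ F ∙ B ^ (m₁ + m₂) ≈ C ∙ S → C̄ ∙ F̄ ∙ B̄ ^ (m₁ + m₂) ≈ C̄ ∙ S̄ →
              ℓ ∙ c̄ ^ m₁ ∙ c ^ m₂ ≈ s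
    closing m₁ m₂ ih ih̄ = begin
      ℓ ∙ c̄ ^ m₁ ∙ c ^ m₂
        ≈⟨ ∙-congʳ (c̄-from-Bb̄ m₁) ⟨
      ℓ ∙ (B ∙ b̄) ^ m₁ ∙ c ^ m₂
        ≈⟨ solve 3 (λ ℓ P Q → ℓ ⊙ P ⊙ Q ⊜ P ⊙ (ℓ ⊙ Q)) ≈-refl ℓ ((B ∙ b̄) ^ m₁) (c ^ m₂) ⟩
      (B ∙ b̄) ^ m₁ ∙ (ℓ ∙ c ^ m₂)
        ≈⟨ ∙-congˡ (c-from-Bb m₂) ⟨
      (B ∙ b̄) ^ m₁ ∙ (ℓ ∙ (B ∙ b) ^ m₂)
        ≈⟨ ∙-cong (^-distrib-∙ B b̄ m₁) (∙-congˡ (^-distrib-∙ B b m₂)) ⟩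
      B ^ m₁ ∙ b̄ ^ m₁ ∙ (ℓ ∙ (B ^ m₂ ∙ b ^ m₂))
        ≈⟨ solve 5 (λ P P̄ ℓ Q Q̄ → P ⊙ P̄ ⊙ (ℓ ⊙ (Q ⊙ Q̄)) ⊜ P̄ ⊙ Q̄ ⊙ ℓ ⊙ (P ⊙ Q)) ≈-refl (B ^ m₁) (b̄ ^ m₁) ℓ (B ^ m₂) (b ^ m₂) ⟩
      b̄ ^ m₁ ∙ b ^ m₂ ∙ ℓ ∙ (B ^ m₁ ∙ B ^ m₂)
        ≈⟨ ∙-cong (∙-congˡ g₃) (^-+ B m₁ m₂) ⟨
      b̄ ^ m₁ ∙ b ^ m₂ ∙ (C ∙ F) ∙ B ^ (m₁ + m₂)
        ≈⟨ solve 5 (λ P Q C F R → P ⊙ Q ⊙ (C ⊙ F) ⊙ R ⊜ P ⊙ Q ⊙ (C ⊙ F ⊙ R)) ≈-refl (b̄ ^ m₁) (b ^ m₂) C F (B ^ (m₁ + m₂)) ⟩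
      b̄ ^ m₁ ∙ b ^ m₂ ∙ (C ∙ F ∙ B ^ (m₁ + m₂))
        ≈⟨ ∙-congˡ ih ⟩
      b̄ ^ m₁ ∙ b ^ m₂ ∙ (C ∙ S)
        ≈⟨ solve 4 (λ P Q C S → P ⊙ Q ⊙ (C ⊙ S) ⊜ Q ⊙ (C ⊙ S ⊙ P)) ≈-refl (b̄ ^ m₁) (b ^ m₂) C S ⟩
      b ^ m₂ ∙ (C ∙ S ∙ b̄ ^ m₁)
        ≈⟨ ∙-congˡ (b̄-to-B̄ m₁) ⟩
      b ^ m₂ ∙ (C ∙ S ∙ B̄ ^ m₁)
        ≈⟨ solve 4 (λ Q C S P → Q ⊙ (C ⊙ S ⊙ P) ⊜ P ⊙ (C ⊙ S ⊙ Q)) ≈-refl (b ^ m₂) C S (B̄ ^ m₁) ⟩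
      B̄ ^ m₁ ∙ (C ∙ S ∙ b ^ m₂)
        ≈⟨ ∙-congˡ (b-to-B̄ m₂) ⟩
      B̄ ^ m₁ ∙ (C ∙ S ∙ B̄ ^ m₂)
        ≈⟨ solve 4 (λ P C S Q → P ⊙ (C ⊙ S ⊙ Q) ⊜ P ⊙ Q ⊙ (C ⊙ S)) ≈-refl (B̄ ^ m₁) C S (B̄ ^ m₂) ⟩
      B̄ ^ m₁ ∙ B̄ ^ m₂ ∙ (C ∙ S)
        ≈⟨ ∙-cong (^-+ B̄ m₁ m₂) g₄ ⟨
      B̄ ^ (m₁ + m₂) ∙ (C̄ ∙ F̄)
        ≈⟨ comm _ _ ⟩
      C̄ ∙ F̄ ∙ B̄ ^ (m₁ + m₂)
        ≈⟨ ih̄ ⟩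
      C̄ ∙ S̄
        ≈⟨ g₇ ⟩
      s ∎

-- Monomials

module _ {n : ℕ} where
  open Sys n using (𝒟-elt; 𝒞-elt)

  ·-assoc : (t u v : Mono n) → (t · u) · v ≡ t · (u · v)
  ·-assoc (mk a) (mk b) (mk c) = cong mk (zipWith-assoc ℕ.+-assoc a b c)

  ·-comm : (t u : Mono n) → t · u ≡ u · t
  ·-comm (mk a) (mk b) = cong mk (zipWith-comm ℕ.+-comm a b)

  ·-identityˡ : (t : Mono n) → ε · t ≡ t
  ·-identityˡ (mk a) = cong mk (zipWith-identityˡ ℕ.+-identityˡ a)

  ·-identityʳ : (t : Mono n) → t · ε ≡ t
  ·-identityʳ (mk a) = cong mk (zipWith-identityʳ ℕ.+-identityʳ a)

  exponent : Mono n → Fin (nv n) → ℕ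
  exponent t i = Vec.lookup (exps t) i

  indicator : Var n → Fin (nv n) → ℕ
  indicator v i = if does (i ≟ enc v) then 1 else 0

  ℓ̂ ĉ̄ ĉ : Fin (nv n)
  ℓ̂ = enc {n} vℓ
  ĉ̄ = enc {n} vc̄
  ĉ = enc {n} vc

  mono-ext : ∀ {t u} → (∀ i → exponent t i ≡ exponent u i) → t ≡ u
  mono-ext {mk a} {mk b} eq = cong mk (Pointwise-≡⇒≡ (ext eq))

  exponent-· : ∀ (t u : Mono n) i → exponent (t · u) i ≡ exponent t i + exponent u i
  exponent-· t u i = lookup-zipWith _+_ i (exps t) (exps u)

  exponent-^ᵐ : ∀ (t : Mono n) k i → exponent (t ^ᵐ k) i ≡ k * exponent t i
  exponent-^ᵐ t k i = lookup-map i (k *_) (exps t)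

  exponent-x : ∀ v i → exponent (x v) i ≡ indicator v i
  exponent-x v i = lookup∘tabulate (indicator v) i

  exponent-∣ᵐ : ∀ {t u} → t ∣ᵐ u → ∀ i → exponent t i ≤ exponent u i
  exponent-∣ᵐ {t} (w , refl) i = subst (exponent t i ≤_) (sym (exponent-· t w i)) (ℕ.m≤m+n _ _)

  ^ᵐ-zero : ∀ (t : Mono n) → t ^ᵐ 0 ≡ ε
  ^ᵐ-zero t = mono-ext λ i → trans (exponent-^ᵐ t 0 i) (sym (lookup-replicate i 0))

  ^ᵐ-suc : ∀ (t : Mono n) k → t ^ᵐ suc k ≡ t · t ^ᵐ k
  ^ᵐ-suc t k = mono-ext λ i → begin
    exponent (t ^ᵐ suc k) i             ≡⟨ exponent-^ᵐ t (suc k) i ⟩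
    exponent t i + k * exponent t i     ≡⟨ cong (exponent t i +_) (exponent-^ᵐ t k i) ⟨
    exponent t i + exponent (t ^ᵐ k) i  ≡⟨ exponent-· t (t ^ᵐ k) i ⟨
    exponent (t · t ^ᵐ k) i             ∎
    where open ≡-Reasoning

  exponent-𝒟 : ∀ j a b i → exponent (𝒟-elt j a b) i ≡ j * indicator vℓ i + a * indicator vc̄ i + b * indicator vc i
  exponent-𝒟 j a b i = begin
    exponent ((x vℓ ^ᵐ j) · (x vc̄ ^ᵐ a) · (x vc ^ᵐ b)) i
      ≡⟨ exponent-· ((x vℓ ^ᵐ j) · (x vc̄ ^ᵐ a)) (x vc ^ᵐ b) i ⟩
    exponent ((x vℓ ^ᵐ j) · (x vc̄ ^ᵐ a)) i + exponent (x vc ^ᵐ b) i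
      ≡⟨ cong (_+ exponent (x vc ^ᵐ b) i) (exponent-· (x vℓ ^ᵐ j) (x vc̄ ^ᵐ a) i) ⟩
    exponent (x vℓ ^ᵐ j) i + exponent (x vc̄ ^ᵐ a) i + exponent (x vc ^ᵐ b) i
      ≡⟨ cong₂ _+_ (cong₂ _+_ (power vℓ j) (power vc̄ a)) (power vc b) ⟩
    j * indicator vℓ i + a * indicator vc̄ i + b * indicator vc i ∎
    where
    open ≡-Reasoning
    power : ∀ v k → exponent (x v ^ᵐ k) i ≡ k * indicator v i
    power v k = trans (exponent-^ᵐ (x v) k i) (cong (k *_) (exponent-x v i))

  private
    at-ℓ : ∀ p q r → p * 1 + q * 0 + r * 0 ≡ p
    at-ℓ = solve-∀
    at-c̄ : ∀ p q r → p * 0 + q * 1 + r * 0 ≡ q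
    at-c̄ = solve-∀
    at-c : ∀ p q r → p * 0 + q * 0 + r * 1 ≡ r
    at-c = solve-∀
    elsewhere : ∀ p q r → p * 0 + q * 0 + r * 0 ≡ 0
    elsewhere = solve-∀

  exponent-𝒟-ℓ : ∀ j a b → exponent (𝒟-elt j a b) ℓ̂ ≡ j
  exponent-𝒟-ℓ j a b = trans (exponent-𝒟 j a b ℓ̂) (at-ℓ j a b)

  exponent-𝒟-c̄ : ∀ j a b → exponent (𝒟-elt j a b) ĉ̄ ≡ a
  exponent-𝒟-c̄ j a b = trans (exponent-𝒟 j a b ĉ̄) (at-c̄ j a b)

  exponent-𝒟-c : ∀ j a b → exponent (𝒟-elt j a b) ĉ ≡ b
  exponent-𝒟-c j a b = trans (exponent-𝒟 j a b ĉ) (at-c j a b)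

  divisor-of-𝒟 : ∀ {t j a b} → t ∣ᵐ 𝒟-elt j a b → t ≡ 𝒟-elt (exponent t ℓ̂) (exponent t ĉ̄) (exponent t ĉ)
  divisor-of-𝒟 {t} {j} {a} {b} t∣ = mono-ext λ i →
    trans (coordinate i (subst (exponent t i ≤_) (exponent-𝒟 j a b i) (exponent-∣ᵐ t∣ i)))
          (sym (exponent-𝒟 tℓ tc̄ tc i))
    where
    tℓ tc̄ tc : ℕ
    tℓ = exponent t ℓ̂
    tc̄ = exponent t ĉ̄
    tc = exponent t ĉ

    formula : ℕ → ℕ → ℕ → Fin (nv n) → ℕ
    formula p q r i = p * indicator vℓ i + q * indicator vc̄ i + r * indicator vc i

    outside : ∀ i → formula j a b i ≡ 0 → formula tℓ tc̄ tc i ≡ 0 →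
              exponent t i ≤ formula j a b i → exponent t i ≡ formula tℓ tc̄ tc i
    outside i f≡0 f′≡0 le = trans (ℕ.n≤0⇒n≡0 (subst (exponent t i ≤_) f≡0 le)) (sym f′≡0)

    -- enc puts s, ℓ, c, c̄ at the coordinates 0, 1, 2, 3, so the indicators compute on these patterns.
    coordinate : ∀ i → exponent t i ≤ formula j a b i → exponent t i ≡ formula tℓ tc̄ tc i
    coordinate i@zero                                   = outside i (elsewhere j a b) (elsewhere tℓ tc̄ tc)
    coordinate (suc zero) _                             = sym (at-ℓ tℓ tc̄ tc)
    coordinate (suc (suc zero)) _                       = sym (at-c tℓ tc̄ tc)
    coordinate (suc (suc (suc zero))) _                 = sym (at-c̄ tℓ tc̄ tc)
    coordinate i@(suc (suc (suc (suc zero))))           = outside i (elsewhere j a b) (elsewhere tℓ tc̄ tc)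
    coordinate i@(suc (suc (suc (suc (suc zero)))))     = outside i (elsewhere j a b) (elsewhere tℓ tc̄ tc)
    coordinate i@(suc (suc (suc (suc (suc (suc _)))))) = outside i (elsewhere j a b) (elsewhere tℓ tc̄ tc)

  𝒞≡𝒟 : ∀ m₁ m₂ → 𝒞-elt m₁ m₂ ≡ 𝒟-elt 1 m₁ m₂
  𝒞≡𝒟 m₁ m₂ = cong (λ t → t · x vc̄ ^ᵐ m₁ · x vc ^ᵐ m₂)
    (sym (trans (^ᵐ-suc (x vℓ) 0) (trans (cong (x vℓ ·_) (^ᵐ-zero (x vℓ))) (·-identityʳ (x vℓ)))))

  exponent-𝒞-c̄ : ∀ m₁ m₂ → exponent (𝒞-elt m₁ m₂) ĉ̄ ≡ m₁
  exponent-𝒞-c̄ m₁ m₂ = trans (cong (λ t → exponent t ĉ̄) (𝒞≡𝒟 m₁ m₂)) (exponent-𝒟-c̄ 1 m₁ m₂)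

  proper-divisor-of-𝒞 : ∀ {t m₁ m₂} → t ∣ᵐ 𝒞-elt m₁ m₂ → t ≢ 𝒞-elt m₁ m₂ →
                        ∃[ j ] ∃[ a ] ∃[ b ] (j ≤ 1 × j + a + b ≤ m₁ + m₂ × t ≡ 𝒟-elt j a b)
  proper-divisor-of-𝒞 {t} {m₁} {m₂} t∣𝒞 t≢𝒞 = tℓ , tc̄ , tc , tℓ≤1 , ℕ.≤-pred sum-bound , t≡𝒟
    where
    t∣𝒟 : t ∣ᵐ 𝒟-elt 1 m₁ m₂
    t∣𝒟 = subst (t ∣ᵐ_) (𝒞≡𝒟 m₁ m₂) t∣𝒞

    tℓ tc̄ tc : ℕ
    tℓ = exponent t ℓ̂
    tc̄ = exponent t ĉ̄
    tc = exponent t ĉ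

    t≡𝒟 : t ≡ 𝒟-elt tℓ tc̄ tc
    t≡𝒟 = divisor-of-𝒟 {t} {1} {m₁} {m₂} t∣𝒟

    bounded : ∀ i {m} → exponent (𝒟-elt 1 m₁ m₂) i ≡ m → exponent t i ≤ m
    bounded i eq = subst (exponent t i ≤_) eq (exponent-∣ᵐ t∣𝒟 i)

    tℓ≤1 : tℓ ≤ 1
    tℓ≤1 = bounded ℓ̂ (exponent-𝒟-ℓ 1 m₁ m₂)

    not-𝒞 : ¬ (tℓ ≡ 1 × tc̄ ≡ m₁ × tc ≡ m₂)
    not-𝒞 (p , q , r) = t≢𝒞 (begin
      t               ≡⟨ t≡𝒟 ⟩
      𝒟-elt tℓ tc̄ tc  ≡⟨ cong₂ (λ j b → 𝒟-elt j tc̄ b) p r ⟩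
      𝒟-elt 1 tc̄ m₂   ≡⟨ cong (λ a → 𝒟-elt 1 a m₂) q ⟩
      𝒟-elt 1 m₁ m₂   ≡⟨ 𝒞≡𝒟 m₁ m₂ ⟨
      𝒞-elt m₁ m₂     ∎)
      where open ≡-Reasoning

    sum-bound : tℓ + tc̄ + tc < 1 + m₁ + m₂
    sum-bound = +-mono-<-unless-equal tℓ≤1 (bounded ĉ̄ (exponent-𝒟-c̄ 1 m₁ m₂)) (bounded ĉ (exponent-𝒟-c 1 m₁ m₂)) not-𝒞

  totalDeg-· : ∀ (t u : Mono n) → totalDeg (t · u) ≡ totalDeg t + totalDeg u
  totalDeg-· (mk a) (mk b) = sum-zipWith a b
    where
    interchange : ∀ p q r s → p + q + (r + s) ≡ p + r + (q + s)
    interchange = solve-∀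
    sum-zipWith : ∀ {m} (a b : Vec ℕ m) → Vec.sum (Vec.zipWith _+_ a b) ≡ Vec.sum a + Vec.sum b
    sum-zipWith []      []      = refl
    sum-zipWith (p ∷ a) (q ∷ b) = trans (cong (p + q +_) (sum-zipWith a b)) (interchange p q (Vec.sum a) (Vec.sum b))

  exponent≤totalDeg : ∀ (t : Mono n) i → exponent t i ≤ totalDeg t
  exponent≤totalDeg (mk a) i = lookup≤sum a i
    where
    lookup≤sum : ∀ {m} (a : Vec ℕ m) i → Vec.lookup a i ≤ Vec.sum a
    lookup≤sum (p ∷ a) zero    = ℕ.m≤m+n p (Vec.sum a)
    lookup≤sum (p ∷ a) (suc i) = ℕ.≤-trans (lookup≤sum a i) (ℕ.m≤n+m (Vec.sum a) p)

  ≤-totalDeg-𝒞 : ∀ m₁ m₂ → m₁ + m₂ ≤ totalDeg (𝒞-elt m₁ m₂)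
  ≤-totalDeg-𝒞 m₁ m₂ = begin
    m₁ + m₂
      ≡⟨ cong₂ _+_ (ℕ.*-identityʳ m₁) (ℕ.*-identityʳ m₂) ⟨
    exponent c̄ᵐ ĉ̄ + exponent cᵐ ĉ
      ≤⟨ ℕ.+-monoˡ-≤ (exponent cᵐ ĉ) (ℕ.≤-trans (exponent≤totalDeg c̄ᵐ ĉ̄) (ℕ.m≤n+m _ (totalDeg (ℓᵐ)))) ⟩
    totalDeg (ℓᵐ) + totalDeg c̄ᵐ + exponent cᵐ ĉ
      ≤⟨ ℕ.+-monoʳ-≤ (totalDeg (ℓᵐ) + totalDeg c̄ᵐ) (exponent≤totalDeg cᵐ ĉ) ⟩
    totalDeg (ℓᵐ) + totalDeg c̄ᵐ + totalDeg cᵐ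
      ≡⟨ cong (_+ totalDeg cᵐ) (totalDeg-· (ℓᵐ) c̄ᵐ) ⟨
    totalDeg (ℓᵐ · c̄ᵐ) + totalDeg cᵐ
      ≡⟨ totalDeg-· (ℓᵐ · c̄ᵐ) cᵐ ⟨
    totalDeg (𝒞-elt m₁ m₂) ∎
    where
    open ℕ.≤-Reasoning
    ℓᵐ c̄ᵐ cᵐ : Mono n
    ℓᵐ = x vℓ
    c̄ᵐ = x vc̄ ^ᵐ m₁
    cᵐ = x vc ^ᵐ m₂

-- Polynomials over ℤ₂, ideal membership and the binomial congruence

module _ {n : ℕ} where

  coeff-∷ : ∀ u t (p : Poly n) → coeff u (t ∷ p) ≡ does (t ≟ᵐ u) xor coeff u p
  coeff-∷ u t p with does (t ≟ᵐ u)
  ... | true  = refl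
  ... | false = refl

  coeff-⊕ : ∀ u (p q : Poly n) → coeff u (p ⊕ q) ≡ coeff u p xor coeff u q
  coeff-⊕ u []      q = refl
  coeff-⊕ u (t ∷ p) q = begin
    coeff u (t ∷ p ⊕ q)                          ≡⟨ coeff-∷ u t (p ⊕ q) ⟩
    does (t ≟ᵐ u) xor coeff u (p ⊕ q)            ≡⟨ cong (does (t ≟ᵐ u) xor_) (coeff-⊕ u p q) ⟩
    does (t ≟ᵐ u) xor (coeff u p xor coeff u q)  ≡⟨ xor-assoc (does (t ≟ᵐ u)) _ _ ⟨
    (does (t ≟ᵐ u) xor coeff u p) xor coeff u q  ≡⟨ cong (_xor coeff u q) (coeff-∷ u t p) ⟨
    coeff u (t ∷ p) xor coeff u q                ∎
    where open ≡-Reasoning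

  coeff-⟦⟧ : ∀ u (t : Mono n) → coeff u ⟦ t ⟧ ≡ does (t ≟ᵐ u)
  coeff-⟦⟧ u t = trans (coeff-∷ u t []) (xor-identityʳ _)

  coeff-⟦⟧-self : ∀ (t : Mono n) → coeff t ⟦ t ⟧ ≡ true
  coeff-⟦⟧-self t = trans (coeff-⟦⟧ t t) (dec-true (t ≟ᵐ t) refl)

  coeff-⟦⟧-other : ∀ {t u : Mono n} → t ≢ u → coeff u ⟦ t ⟧ ≡ false
  coeff-⟦⟧-other {t} {u} t≢u = trans (coeff-⟦⟧ u t) (dec-false (t ≟ᵐ u) t≢u)

  coeff-⟦⟧≡true : ∀ {t u : Mono n} → coeff u ⟦ t ⟧ ≡ true → t ≡ u
  coeff-⟦⟧≡true {t} {u} c with t ≟ᵐ u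
  ... | yes t≡u = t≡u
  ... | no t≢u  = case trans (sym c) (coeff-⟦⟧-other t≢u) of λ ()

  coeff⇒∈ : ∀ (p : Poly n) {u} → coeff u p ≡ true → u ∈ p
  coeff⇒∈ []      ()
  coeff⇒∈ (t ∷ p) {u} c with t ≟ᵐ u
  ... | yes refl = here refl
  ... | no t≢u   = there (coeff⇒∈ p (trans (sym coeff-tail) c))
    where
    coeff-tail : coeff u (t ∷ p) ≡ coeff u p
    coeff-tail = trans (coeff-∷ u t p) (cong (_xor coeff u p) (dec-false (t ≟ᵐ u) t≢u))

  ≤-deg : ∀ (p : Poly n) {u} → coeff u p ≡ true → totalDeg u ≤ deg p
  ≤-deg p {u} pᵤ = go p (coeff⇒∈ p pᵤ)
    where
    go : ∀ qs → u ∈ qs → totalDeg u ≤ List.foldr (λ v m → if coeff v p then totalDeg v ⊔ m else m) 0 qs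
    go (v ∷ qs) (here refl) rewrite pᵤ = ℕ.m≤m⊔n (totalDeg u) _
    go (v ∷ qs) (there u∈qs) with coeff v p
    ... | true  = ℕ.≤-trans (go qs u∈qs) (ℕ.m≤n⊔m (totalDeg v) _)
    ... | false = go qs u∈qs

  lincomb-++ : (cs ds : List (Poly n × Poly n)) → lincomb (cs ++ ds) ≡ lincomb cs ⊕ lincomb ds
  lincomb-++ []             ds = refl
  lincomb-++ ((h , f) ∷ cs) ds =
    trans (cong (h ⊗ f ⊕_) (lincomb-++ cs ds)) (sym (++-assoc (h ⊗ f) (lincomb cs) (lincomb ds)))

  module _ {F : List (Poly n)} where

    ∈⟨⟩-resp-≈ : ∀ {p q} → p ≈ᵖ q → q ∈⟨ F ⟩ → p ∈⟨ F ⟩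
    ∈⟨⟩-resp-≈ p≈q (cs , cs⊆F , q≈) = cs , cs⊆F , λ t → trans (p≈q t) (q≈ t)

    ∈⟨⟩-⊕ : ∀ {p q} → p ∈⟨ F ⟩ → q ∈⟨ F ⟩ → (p ⊕ q) ∈⟨ F ⟩
    ∈⟨⟩-⊕ {p} {q} (cs , cs⊆F , p≈) (ds , ds⊆F , q≈) = cs ++ ds , ++⁺ cs⊆F ds⊆F , λ t → begin
      coeff t (p ⊕ q)                                ≡⟨ coeff-⊕ t p q ⟩
      coeff t p xor coeff t q                        ≡⟨ cong₂ _xor_ (p≈ t) (q≈ t) ⟩
      coeff t (lincomb cs) xor coeff t (lincomb ds)  ≡⟨ coeff-⊕ t (lincomb cs) (lincomb ds) ⟨
      coeff t (lincomb cs ⊕ lincomb ds)              ≡⟨ cong (coeff t) (lincomb-++ cs ds) ⟨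
      coeff t (lincomb (cs ++ ds))                   ∎
      where open ≡-Reasoning

    IdealCongruent : Rel (Mono n) 0ℓ
    IdealCongruent t u = (⟦ t ⟧ ⊕ ⟦ u ⟧) ∈⟨ F ⟩

    IdealCongruent-isEquivalence : IsEquivalence IdealCongruent
    IdealCongruent-isEquivalence = record
      { refl  = λ {t} → [] , [] , λ u → trans (coeff-⊕ u ⟦ t ⟧ ⟦ t ⟧) (xor-same (coeff u ⟦ t ⟧))
      ; sym   = λ {t} {u} → ∈⟨⟩-resp-≈ {⟦ u ⟧ ⊕ ⟦ t ⟧} {⟦ t ⟧ ⊕ ⟦ u ⟧} (swap t u)
      ; trans = λ {t} {u} {v} t~u u~v →
          ∈⟨⟩-resp-≈ {⟦ t ⟧ ⊕ ⟦ v ⟧} {(⟦ t ⟧ ⊕ ⟦ u ⟧) ⊕ (⟦ u ⟧ ⊕ ⟦ v ⟧)} (through t u v)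
                     (∈⟨⟩-⊕ {⟦ t ⟧ ⊕ ⟦ u ⟧} {⟦ u ⟧ ⊕ ⟦ v ⟧} t~u u~v)
      }
      where
      open ≡-Reasoning

      swap : ∀ (t u : Mono n) → (⟦ u ⟧ ⊕ ⟦ t ⟧) ≈ᵖ (⟦ t ⟧ ⊕ ⟦ u ⟧)
      swap t u w = begin
        coeff w (⟦ u ⟧ ⊕ ⟦ t ⟧)             ≡⟨ coeff-⊕ w ⟦ u ⟧ ⟦ t ⟧ ⟩
        coeff w ⟦ u ⟧ xor coeff w ⟦ t ⟧     ≡⟨ xor-comm (coeff w ⟦ u ⟧) (coeff w ⟦ t ⟧) ⟩
        coeff w ⟦ t ⟧ xor coeff w ⟦ u ⟧     ≡⟨ coeff-⊕ w ⟦ t ⟧ ⟦ u ⟧ ⟨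
        coeff w (⟦ t ⟧ ⊕ ⟦ u ⟧)             ∎

      through : ∀ (t u v : Mono n) → (⟦ t ⟧ ⊕ ⟦ v ⟧) ≈ᵖ ((⟦ t ⟧ ⊕ ⟦ u ⟧) ⊕ (⟦ u ⟧ ⊕ ⟦ v ⟧))
      through t u v w = begin
        coeff w (⟦ t ⟧ ⊕ ⟦ v ⟧)                              ≡⟨ coeff-⊕ w ⟦ t ⟧ ⟦ v ⟧ ⟩
        a xor c                                              ≡⟨ cong (λ z → a xor (z xor c)) (xor-same b) ⟨
        a xor ((b xor b) xor c)                              ≡⟨ cong (a xor_) (xor-assoc b b c) ⟩
        a xor (b xor (b xor c))                              ≡⟨ xor-assoc a b (b xor c) ⟨
        (a xor b) xor (b xor c)                              ≡⟨ cong₂ _xor_ (coeff-⊕ w ⟦ t ⟧ ⟦ u ⟧) (coeff-⊕ w ⟦ u ⟧ ⟦ v ⟧) ⟨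
        coeff w (⟦ t ⟧ ⊕ ⟦ u ⟧) xor coeff w (⟦ u ⟧ ⊕ ⟦ v ⟧)  ≡⟨ coeff-⊕ w (⟦ t ⟧ ⊕ ⟦ u ⟧) (⟦ u ⟧ ⊕ ⟦ v ⟧) ⟨
        coeff w ((⟦ t ⟧ ⊕ ⟦ u ⟧) ⊕ (⟦ u ⟧ ⊕ ⟦ v ⟧))          ∎
        where
        a b c : Bool
        a = coeff w ⟦ t ⟧
        b = coeff w ⟦ u ⟧
        c = coeff w ⟦ v ⟧

    data Rewrites : Rel (Mono n) 0ℓ where
      replace : ∀ w {a b} → (a ∷ b ∷ []) ∈ F → Rewrites (w · a) (w · b)

    BinomialCongruence : Rel (Mono n) 0ℓ
    BinomialCongruence = EqClosure Rewrites

    binomial⇒congruent : ∀ {a b} → (a ∷ b ∷ []) ∈ F → BinomialCongruence a b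
    binomial⇒congruent {a} {b} ab∈F =
      EqClosure.return (subst₂ Rewrites (·-identityˡ a) (·-identityˡ b) (replace ε ab∈F))

    congruent⇒idealCongruent : ∀ {t u} → BinomialCongruence t u → IdealCongruent t u
    congruent⇒idealCongruent = EqClosure.fold IdealCongruent-isEquivalence rewrites⇒idealCongruent
      where
      -- ⟦ w ⟧ ⊗ (a ∷ b ∷ []) computes to w · a ∷ w · b ∷ [], so one summand suffices.
      rewrites⇒idealCongruent : ∀ {t u} → Rewrites t u → IdealCongruent t u
      rewrites⇒idealCongruent (replace w {a} {b} ab∈F) = (⟦ w ⟧ , (a ∷ b ∷ [])) ∷ [] , ab∈F ∷ [] , λ _ → refl

    binomialQuotient : CommutativeMonoid 0ℓ 0ℓ
    binomialQuotient = record
      { Carrier = Mono n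
      ; _≈_ = BinomialCongruence
      ; _∙_ = _·_
      ; ε = ε
      ; isCommutativeMonoid = record
        { isMonoid = record
          { isSemigroup = record
            { isMagma = record { isEquivalence = EqClosure.isEquivalence Rewrites ; ∙-cong = ·-cong }
            ; assoc = λ t u v → ≡⇒congruent (·-assoc t u v)
            }
          ; identity = (λ t → ≡⇒congruent (·-identityˡ t)) , (λ t → ≡⇒congruent (·-identityʳ t))
          }
        ; comm = λ t u → ≡⇒congruent (·-comm t u)
        }
      }
      where
      ≡⇒congruent : ∀ {t u} → t ≡ u → BinomialCongruence t u
      ≡⇒congruent refl = EqClosure.reflexive Rewrites

      ·-congˡ : ∀ w {t u} → BinomialCongruence t u → BinomialCongruence (w · t) (w · u)
      ·-congˡ w = EqClosure.gmap (w ·_) rewrites-·ˡ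
        where
        rewrites-·ˡ : ∀ {t u} → Rewrites t u → Rewrites (w · t) (w · u)
        rewrites-·ˡ (replace v {a} {b} ab∈F) =
          subst₂ Rewrites (·-assoc w v a) (·-assoc w v b) (replace (w · v) ab∈F)

      ·-cong : ∀ {t t′ u u′} → BinomialCongruence t t′ → BinomialCongruence u u′ →
               BinomialCongruence (t · u) (t′ · u′)
      ·-cong {t} {t′} {u} {u′} t~t′ u~u′ = EqClosure.transitive Rewrites
        (subst₂ BinomialCongruence (·-comm u t) (·-comm u t′) (·-congˡ u t~t′)) (·-congˡ t′ u~u′)

-- Leading monomials

module _ {n : ℕ} (O : MonomialOrder n) where
  open MonomialOrder O
  open IsTotalOrder isTotalOrder using (antisym; reflexive) renaming (refl to ≼-refl)

  IsLM-unique : ∀ {p t u} → IsLM O p t → IsLM O p u → t ≡ u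
  IsLM-unique (pₜ , t-max) (pᵤ , u-max) = antisym (u-max _ pₜ) (t-max _ pᵤ)

  IsLM-⟦⟧ : ∀ t → IsLM O ⟦ t ⟧ t
  IsLM-⟦⟧ t = coeff-⟦⟧-self t , λ u c → reflexive (sym (coeff-⟦⟧≡true c))

  IsLM-binomial : ∀ {t u} → _≺_ O u t → IsLM O (⟦ t ⟧ ⊕ ⟦ u ⟧) t
  IsLM-binomial {t} {u} (u≼t , u≢t) = leading , maximal
    where
    leading : coeff t (⟦ t ⟧ ⊕ ⟦ u ⟧) ≡ true
    leading = trans (coeff-⊕ t ⟦ t ⟧ ⟦ u ⟧) (cong₂ _xor_ (coeff-⟦⟧-self t) (coeff-⟦⟧-other u≢t))

    maximal : ∀ v → coeff v (⟦ t ⟧ ⊕ ⟦ u ⟧) ≡ true → v ≼ t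
    maximal v c with t ≟ᵐ v | u ≟ᵐ v
    ... | yes refl | _        = ≼-refl
    ... | no _     | yes refl = u≼t
    ... | no t≢v   | no u≢v   = case trans (sym c) (trans (coeff-⊕ v ⟦ t ⟧ ⟦ u ⟧)
                                  (cong₂ _xor_ (coeff-⟦⟧-other t≢v) (coeff-⟦⟧-other u≢v))) of λ ()

  leading-not-⊑-cancelled : ∀ {g t} → IsLM O g t → ¬ (_⊑_ O ⟦ t ⟧ (g ⊕ ⟦ t ⟧))
  leading-not-⊑-cancelled {g} {t} (gₜ , g-max) = λ where
      (⊑-eq t≈g+t) →
        irreflexive (remaining-below t (trans (sym (t≈g+t t)) (coeff-⟦⟧-self t)))
      (⊑-zero t≈0 _) →
        case trans (sym (coeff-⟦⟧-self t)) (t≈0 t) of λ ()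
      (⊑-lt t′ u lmₜ (uₜ , _) t′≺u) →
        let u≺t = remaining-below u uₜ
            t≼u = subst (_≼ u) (is-t lmₜ) (proj₁ t′≺u)
        in irreflexive (subst (_≺_ O u) (antisym t≼u (proj₁ u≺t)) u≺t)
      (⊑-step t′ lmₜ (t′ₜ , _) _) →
        irreflexive (remaining-below t (subst (λ v → coeff v (g ⊕ ⟦ t ⟧) ≡ true) (is-t lmₜ) t′ₜ))
    where
    is-t : ∀ {t′} → IsLM O ⟦ t ⟧ t′ → t′ ≡ t
    is-t lmₜ = IsLM-unique {⟦ t ⟧} lmₜ (IsLM-⟦⟧ t)

    irreflexive : ∀ {v} → ¬ (_≺_ O v v)
    irreflexive (_ , v≢v) = v≢v refl

    remaining-below : ∀ u → coeff u (g ⊕ ⟦ t ⟧) ≡ true → _≺_ O u t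
    remaining-below u c with t ≟ᵐ u
    ... | yes refl = case trans (sym c) (trans (coeff-⊕ t g ⟦ t ⟧) (cong₂ _xor_ gₜ (coeff-⟦⟧-self t))) of λ ()
    ... | no t≢u   = g-max u (trans (sym uᵍ) c) , λ u≡t → t≢u (sym u≡t)
      where
      uᵍ : coeff u (g ⊕ ⟦ t ⟧) ≡ coeff u g
      uᵍ = trans (coeff-⊕ u g ⟦ t ⟧) (trans (cong (coeff u g xor_) (coeff-⟦⟧-other t≢u)) (xor-identityʳ _))

  minimal-not-leading : ∀ {F g t} → (∀ f → IdealRes F ⟦ t ⟧ f → _⊑_ O ⟦ t ⟧ f) →
                        g ∈⟨ F ⟩ → ¬ IsLM O g t
  minimal-not-leading {F} {g} {t} minimal g∈F lm = leading-not-⊑-cancelled lm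
    (minimal (g ⊕ ⟦ t ⟧) (∈⟨⟩-resp-≈ {F = F} {⟦ t ⟧ ⊕ (g ⊕ ⟦ t ⟧)} {g} t+g+t≈g g∈F))
    where
    t+g+t≈g : (⟦ t ⟧ ⊕ (g ⊕ ⟦ t ⟧)) ≈ᵖ g
    t+g+t≈g v = begin
      coeff v (⟦ t ⟧ ⊕ (g ⊕ ⟦ t ⟧))             ≡⟨ coeff-⊕ v ⟦ t ⟧ (g ⊕ ⟦ t ⟧) ⟩
      T xor coeff v (g ⊕ ⟦ t ⟧)                 ≡⟨ cong (T xor_) (trans (coeff-⊕ v g ⟦ t ⟧) (xor-comm (coeff v g) T)) ⟩
      T xor (T xor coeff v g)                   ≡⟨ xor-assoc T T (coeff v g) ⟨
      (T xor T) xor coeff v g                   ≡⟨ cong (_xor coeff v g) (xor-same T) ⟩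
      coeff v g                                 ∎
      where
      open ≡-Reasoning
      T : Bool
      T = coeff v ⟦ t ⟧

-- The system ℱ

module System (n : ℕ) where
  open Sys n

  private
    module M = CommutativeMonoid (binomialQuotient {n} {ℱ})
  open M using (setoid) renaming (_≈_ to _∼_)
  open InCommutativeMonoid (binomialQuotient {n} {ℱ})
  open import Algebra.Solver.CommutativeMonoid (binomialQuotient {n} {ℱ}) using (solve; _⊜_; id)
  open import Relation.Binary.Reasoning.Setoid setoid

  ∏ : List (Var n) → Mono n
  ∏ []       = ε
  ∏ (v ∷ ws) = foldl (λ t w → t · x w) (x v) ws

  ∏≡mon : ∀ ws → ∏ ws ≡ mon ws
  ∏≡mon []       = refl
  ∏≡mon (v ∷ ws) = foldl≡ (x v) ws
    where
    foldl≡ : ∀ t ws → foldl (λ t w → t · x w) t ws ≡ t · mon ws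
    foldl≡ t []       = sym (·-identityʳ t)
    foldl≡ t (w ∷ ws) = trans (foldl≡ (t · x w) ws) (·-assoc t (x w) (mon ws))

  generator : ∀ as bs → bin as bs ∈ ℱ → ∏ as ∼ ∏ bs
  generator as bs ab∈ℱ = subst₂ _∼_ (sym (∏≡mon as)) (sym (∏≡mon bs)) (binomial⇒congruent ab∈ℱ)

  𝒫⊆ℱ : ∀ β {p} → p ∈ 𝒫 β → p ∈ ℱ
  𝒫⊆ℱ false p∈ = ∈-++⁺ˡ p∈
  𝒫⊆ℱ true  p∈ = ∈-++⁺ʳ (𝒫 false) (∈-++⁺ˡ p∈)

  P₀⊆ℱ : ∀ β {p} → p ∈ P₀ β → p ∈ ℱ
  P₀⊆ℱ β p∈ = 𝒫⊆ℱ β (∈-++⁺ˡ p∈)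

  Pₘ⊆ℱ : ∀ β j {p} → p ∈ Pₘ β j → p ∈ ℱ
  Pₘ⊆ℱ β j p∈ = 𝒫⊆ℱ β (∈-++⁺ʳ (P₀ β) (∈-concat⁺′ p∈ (∈-map⁺ (Pₘ β) (∈-allFin j))))

  𝒢⊆ℱ : ∀ {p} → p ∈ 𝒢 → p ∈ ℱ
  𝒢⊆ℱ p∈ = ∈-++⁺ʳ (𝒫 false) (∈-++⁺ʳ (𝒫 true) p∈)

  LevelRelation : Bool → Fin (suc n) → ℕ → Set
  LevelRelation β i E = ∀ k → x (C β k i) · x (F β i) · x (B β k i) ^ E ∼ x (C β k i) · x (S β i)

  level-zero : ∀ β → LevelRelation β zero 2
  level-zero β k = M.trans
    (solve 3 (λ c f b → c ⊙ f ⊙ (b ⊙ (b ⊙ id)) ⊜ b ⊙ b ⊙ c ⊙ f) M.refl (x (C β k zero)) (x (F β zero)) (x (B β k zero)))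
    (generator (lhs k) (rhs k) (P₀⊆ℱ β (∈-map⁺ (λ k → bin (lhs k) (rhs k)) (∈-allFin k))))
    where
    lhs rhs : Fin 4 → List (Var n)
    lhs k = B β k zero ∷ B β k zero ∷ C β k zero ∷ F β zero ∷ []
    rhs k = C β k zero ∷ S β zero ∷ []

  level-suc : ∀ β j {E} .{{_ : NonZero E}} → LevelRelation β (inject₁ j) E → LevelRelation β (suc j) (E * E)
  level-suc β j {suc d} ih i = Squaring.squaring
    (x (Q β k₁ m)) (x (Q β k₂ m)) (x (Q β k₃ m)) (x (Q β k₄ m))
    (x (C β k₁ p)) (x (C β k₂ p)) (x (C β k₃ p)) (x (C β k₄ p))
    (x (B β k₁ p)) (x (B β k₂ p)) (x (B β k₃ p)) (x (B β k₄ p))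
    (x (S β p)) (x (F β p)) (x (S β m)) (x (F β m)) (x (B β i m)) (x (C β i m)) d
    (generator (Q β k₁ m ∷ C β k₁ p ∷ S β p ∷ []) (S β m ∷ []) (Pₘ∈ℱ (# 0)))
    (generator (Q β k₂ m ∷ C β k₂ p ∷ S β p ∷ []) (Q β k₁ m ∷ B β k₁ p ∷ C β k₁ p ∷ F β p ∷ []) (Pₘ∈ℱ (# 1)))
    (generator (Q β k₃ m ∷ C β k₃ p ∷ F β p ∷ []) (Q β k₂ m ∷ C β k₂ p ∷ F β p ∷ []) (Pₘ∈ℱ (# 2)))
    (generator (Q β k₃ m ∷ B β k₁ p ∷ C β k₃ p ∷ S β p ∷ []) (Q β k₂ m ∷ B β k₄ p ∷ C β k₂ p ∷ S β p ∷ []) (Pₘ∈ℱ (# 3)))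
    (generator (Q β k₄ m ∷ B β k₄ p ∷ C β k₄ p ∷ F β p ∷ []) (Q β k₃ m ∷ C β k₃ p ∷ S β p ∷ []) (Pₘ∈ℱ (# 4)))
    (generator (Q β k₄ m ∷ C β k₄ p ∷ S β p ∷ []) (F β m ∷ []) (Pₘ∈ℱ (# 5)))
    (generator (p₇-lhs i) (p₇-rhs i)
               (Pₘ⊆ℱ β j (there (there (there (there (there (there (∈-map⁺ (λ i → bin (p₇-lhs i) (p₇-rhs i)) (∈-allFin i))))))))))
    (ih k₁) (ih k₂) (ih k₃) (ih k₄)
    where
    m p : Fin (suc n)
    m = suc j
    p = inject₁ j
    p₇-lhs p₇-rhs : Fin 4 → List (Var n)
    p₇-lhs i = Q β k₂ m ∷ B β k₃ p ∷ B β i m ∷ C β i m ∷ F β p ∷ []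
    p₇-rhs i = Q β k₂ m ∷ B β k₂ p ∷ C β i m ∷ F β p ∷ []
    Pₘ∈ℱ : ∀ k → lookup (Pₘ β j) k ∈ ℱ
    Pₘ∈ℱ k = Pₘ⊆ℱ β j (∈-lookup k)

  level : ∀ β i → LevelRelation β i (e (toℕ i))
  level β = <-weakInduction (λ i → LevelRelation β i (e (toℕ i))) (level-zero β) step
    where
    step : ∀ j → LevelRelation β (inject₁ j) (e (toℕ (inject₁ j))) → LevelRelation β (suc j) (e (suc (toℕ j)))
    step j ih = subst (LevelRelation β (suc j)) (sym (e-suc (toℕ j)))
      (level-suc β j {{e-nonZero (toℕ j)}} (subst (LevelRelation β (inject₁ j)) (cong e (Finₚ.toℕ-inject₁ j)) ih))

  ^≡^ᵐ : ∀ t k → t ^ k ≡ t ^ᵐ k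
  ^≡^ᵐ t zero    = sym (^ᵐ-zero t)
  ^≡^ᵐ t (suc k) = trans (cong (t ·_) (^≡^ᵐ t k)) (sym (^ᵐ-suc t k))

  𝒞∼s : ∀ m₁ m₂ → m₁ + m₂ ≡ e n → 𝒞-elt m₁ m₂ ∼ x vs
  𝒞∼s m₁ m₂ m₁+m₂≡e = subst (_∼ x vs) (cong₂ (λ u v → x vℓ · u · v) (^≡^ᵐ (x vc̄) m₁) (^≡^ᵐ (x vc) m₂))
    (Closing.closing
      (x vℓ) (x vc) (x vc̄) (x vb) (x vb̄)
      (x (B false k₄ N)) (x (C false k₄ N)) (x (F false N)) (x (S false N))
      (x (B true k₄ N)) (x (C true k₄ N)) (x (F true N)) (x (S true N)) (x vs)
      (generator (B false k₄ N ∷ vℓ ∷ vb ∷ []) (vℓ ∷ vc ∷ []) (𝒢∈ℱ (# 0)))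
      (generator (B false k₄ N ∷ vℓ ∷ vb̄ ∷ []) (vℓ ∷ vc̄ ∷ []) (𝒢∈ℱ (# 1)))
      (generator (C false k₄ N ∷ F false N ∷ []) (vℓ ∷ []) (𝒢∈ℱ (# 2)))
      (generator (C true k₄ N ∷ F true N ∷ []) (C false k₄ N ∷ S false N ∷ []) (𝒢∈ℱ (# 3)))
      (generator (B true k₄ N ∷ C false k₄ N ∷ S false N ∷ []) (C false k₄ N ∷ S false N ∷ vb ∷ []) (𝒢∈ℱ (# 4)))
      (generator (B true k₄ N ∷ C false k₄ N ∷ S false N ∷ []) (C false k₄ N ∷ S false N ∷ vb̄ ∷ []) (𝒢∈ℱ (# 5)))
      (generator (C true k₄ N ∷ S true N ∷ []) (vs ∷ []) (𝒢∈ℱ (# 6)))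
      m₁ m₂ (top false k₄) (top true k₄))
    where
    𝒢∈ℱ : ∀ k → lookup 𝒢 k ∈ ℱ
    𝒢∈ℱ k = 𝒢⊆ℱ (∈-lookup k)

    top : ∀ β → LevelRelation β N (m₁ + m₂)
    top β = subst (LevelRelation β N) (trans (cong e (Finₚ.toℕ-fromℕ n)) (sym m₁+m₂≡e)) (level β N)

module GröbnerBasis (n : ℕ) (O : MonomialOrder n)
  (s≺𝒞 : ∀ m₁ m₂ → m₁ + m₂ ≡ e n → _≺_ O (x vs) (Sys.𝒞-elt n m₁ m₂))
  (𝒟-minimal : ∀ j m₁ m₂ → j ≤ 1 → j + m₁ + m₂ ≤ e n → ∀ f →
               IdealRes (Sys.ℱ n) ⟦ Sys.𝒟-elt n j m₁ m₂ ⟧ f → _⊑_ O ⟦ Sys.𝒟-elt n j m₁ m₂ ⟧ f)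
  {G : List (Poly n)} (G-basis : IsReducedGB O (Sys.ℱ n) G)
  where

  open Sys n
  open IsReducedGB G-basis

  𝒞-is-leading : ∀ m₁ m₂ → m₁ + m₂ ≡ e n → ∃[ g ] (g ∈ G × IsLM O g (𝒞-elt m₁ m₂))
  𝒞-is-leading m₁ m₂ m₁+m₂≡e = divisor-is-α (leading (⟦ α ⟧ ⊕ ⟦ x vs ⟧) α+s∈ℱ α+s≢0)
    where
    α : Mono n
    α = 𝒞-elt m₁ m₂

    α+s∈ℱ : (⟦ α ⟧ ⊕ ⟦ x vs ⟧) ∈⟨ ℱ ⟩
    α+s∈ℱ = congruent⇒idealCongruent (System.𝒞∼s n m₁ m₂ m₁+m₂≡e)

    α-lm : IsLM O (⟦ α ⟧ ⊕ ⟦ x vs ⟧) α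
    α-lm = IsLM-binomial O (s≺𝒞 m₁ m₂ m₁+m₂≡e)

    α+s≢0 : ¬ ((⟦ α ⟧ ⊕ ⟦ x vs ⟧) ≈ᵖ 0ᵖ)
    α+s≢0 α+s≈0 = case trans (sym (proj₁ α-lm)) (α+s≈0 α) of λ ()

    divisor-is-α : ∃[ g ] ∃[ t ] ∃[ u ] (g ∈ G × IsLM O g t × IsLM O (⟦ α ⟧ ⊕ ⟦ x vs ⟧) u × t ∣ᵐ u) →
                   ∃[ g ] (g ∈ G × IsLM O g α)
    divisor-is-α (g , t , u , g∈G , g-lm , p-lm , t∣u) with t ≟ᵐ α
    ... | yes refl = g , g∈G , g-lm
    ... | no t≢α   = case proper-divisor-of-𝒞 {t = t} {m₁} {m₂} t∣α t≢α of λ where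
        (j , a , b , j≤1 , j+a+b≤ , refl) → case minimal-not-leading O {ℱ} {g}
          (𝒟-minimal j a b j≤1 (subst (j + a + b ≤_) m₁+m₂≡e j+a+b≤)) (All.lookup inIdeal g∈G) g-lm of λ ()
      where
      t∣α : t ∣ᵐ α
      t∣α = subst (t ∣ᵐ_) (IsLM-unique O {⟦ α ⟧ ⊕ ⟦ x vs ⟧} p-lm α-lm) t∣u

  many-high-degree-elements : suc (e n) ≤ length (filter (λ p → e n ≤? deg p) G)
  many-high-degree-elements = injection⇒≤length _ g g∈filter g-injective
    where
    α : Fin (suc (e n)) → Mono n
    α i = 𝒞-elt (toℕ i) (e n ∸ toℕ i)

    sums-to-e : ∀ i → toℕ i + (e n ∸ toℕ i) ≡ e n
    sums-to-e i = ℕ.m+[n∸m]≡n (Finₚ.toℕ≤pred[n] i)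

    leader : ∀ i → ∃[ g ] (g ∈ G × IsLM O g (α i))
    leader i = 𝒞-is-leading (toℕ i) (e n ∸ toℕ i) (sums-to-e i)

    g : Fin (suc (e n)) → Poly n
    g i = proj₁ (leader i)

    g-lm : ∀ i → IsLM O (g i) (α i)
    g-lm i = proj₂ (proj₂ (leader i))

    g∈filter : ∀ i → g i ∈ filter (λ p → e n ≤? deg p) G
    g∈filter i = ∈-filter⁺ (λ p → e n ≤? deg p) (proj₁ (proj₂ (leader i)))
      (ℕ.≤-trans (subst (_≤ totalDeg (α i)) (sums-to-e i) (≤-totalDeg-𝒞 {n} (toℕ i) (e n ∸ toℕ i)))
                 (≤-deg (g i) {α i} (proj₁ (g-lm i))))

    g-injective : ∀ {i j} → g i ≡ g j → i ≡ j
    g-injective {i} {j} gᵢ≡gⱼ = Finₚ.toℕ-injective (begin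
      toℕ i                   ≡⟨ exponent-𝒞-c̄ {n} (toℕ i) (e n ∸ toℕ i) ⟨
      exponent (α i) (ĉ̄ {n})  ≡⟨ cong (λ t → exponent t (ĉ̄ {n})) αᵢ≡αⱼ ⟩
      exponent (α j) (ĉ̄ {n})  ≡⟨ exponent-𝒞-c̄ {n} (toℕ j) (e n ∸ toℕ j) ⟩
      toℕ j                   ∎)
      where
      open ≡-Reasoning
      αᵢ≡αⱼ : α i ≡ α j
      αᵢ≡αⱼ = IsLM-unique O {g i} (g-lm i) (subst (λ h → IsLM O h (α j)) (sym gᵢ≡gⱼ) (g-lm j))

theorem4p1 : (n : ℕ) (O : MonomialOrder n) →
    (∀ m₁ m₂ → m₁ + m₂ ≡ e n → _≺_ O (x vs) (Sys.𝒞-elt n m₁ m₂)) →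
    (∀ j m₁ m₂ → j ≤ 1 → j + m₁ + m₂ ≤ e n → ∀ f →
       IdealRes (Sys.ℱ n) ⟦ Sys.𝒟-elt n j m₁ m₂ ⟧ f →
       _⊑_ O ⟦ Sys.𝒟-elt n j m₁ m₂ ⟧ f) →
    ∀ G → IsReducedGB O (Sys.ℱ n) G →
    e n ≤ length G × e n ≤ length (filter (λ p → e n ≤? deg p) G)
theorem4p1 n O s≺𝒞 𝒟-minimal G G-basis = ℕ.≤-trans e≤high (length-filter (λ p → e n ≤? deg p) G) , e≤high
  where
  e≤high : e n ≤ length (filter (λ p → e n ≤? deg p) G)
  e≤high = ℕ.≤-trans (ℕ.n≤1+n (e n)) (GröbnerBasis.many-high-degree-elements n O s≺𝒞 𝒟-minimal G-basis)
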